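{- Let $G$ be a cactus graph on $n$ vertices with at least two cycles, containing a $4$-cycle, such that for every $4$-cycle $C$ of $G$ there are no two adjacent vertices of $C$ that each have a neighbor not on $C$. Then $\operatorname{Z}(\overline{G})\geq n-3$.
   Context: All graphs are finite, simple and undirected. A cactus graph is a connected graph in which any two simple cycles have at most one vertex in common. $\overline{G}$ denotes the complement of $G$ (same vertex set; distinct vertices adjacent iff not adjacent in $G$). Zero forcing: given an initial set $B\subseteq V(G)$ of blue vertices (all others white), a blue vertex with exactly one white neighbor may turn that neighbor blue; $B$ is a zero forcing set if repeated application makes all vertices blue. $\operatorname{Z}(G)$ is the minimum size of a zero forcing set of $G$. -}

module Defs where

open import Data.Nat using (ℕ; suc; _≥_; _∸_)
open import Data.Fin using (Fin)
open import Data.Fin.Subset using (Subset; _∈_; _∉_; ∣_∣)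
open import Data.List using (List; []; _∷_; length; head; last)
open import Data.List.Membership.Propositional using () renaming (_∈_ to _∈ₗ_; _∉_ to _∉ₗ_)
open import Data.List.Relation.Unary.Unique.Propositional using (Unique)
open import Data.Maybe using (Maybe; just; nothing)
open import Data.Product using (_×_; Σ; ∃; ∃-syntax; _,_)
open import Data.Sum using (_⊎_)
open import Data.Empty using (⊥)
open import Data.Unit using (⊤)
open import Relation.Nullary using (¬_)
open import Relation.Binary.PropositionalEquality using (_≡_; _≢_)
open import Level using (0ℓ)

record Graph (n : ℕ) : Set₁ where
  field
    Adj   : Fin n → Fin n → Set
    sym   : ∀ {u v} → Adj u v → Adj v u
    irrefl : ∀ {u} → ¬ Adj u u
open Graph public

complement : ∀ {n} → Graph n → Graph n
complement G = record
  { Adj = λ u v → u ≢ v × ¬ Adj G u v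
  ; sym = λ { (u≢v , ¬a) → (λ e → u≢v (Relation.Binary.PropositionalEquality.sym e)) , (λ a → ¬a (Graph.sym G a)) }
  ; irrefl = λ { (u≢u , _) → u≢u _≡_.refl }
  }

data Reach {n} (G : Graph n) : Fin n → Fin n → Set where
  here : ∀ {u} → Reach G u u
  step : ∀ {u v w} → Adj G u v → Reach G v w → Reach G u w

Connected : ∀ {n} → Graph n → Set
Connected G = ∀ u v → Reach G u v

data Path {n} (G : Graph n) : List (Fin n) → Set where
  nil  : Path G []
  one  : ∀ {v} → Path G (v ∷ [])
  cons : ∀ {u v vs} → Adj G u v → Path G (v ∷ vs) → Path G (u ∷ v ∷ vs)

record Cycle {n} (G : Graph n) : Set where
  constructor mkCycle
  field
    verts    : List (Fin n)
    long     : length verts ≥ 3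
    distinct : Unique verts
    path     : Path G verts
    closing  : ∀ {a b} → head verts ≡ just a → last verts ≡ just b → Adj G b a
open Cycle public

data ConsecIn {n} : List (Fin n) → Fin n → Fin n → Set where
  atHead : ∀ {u v vs} → ConsecIn (u ∷ v ∷ vs) u v
  later  : ∀ {u vs a b} → ConsecIn vs a b → ConsecIn (u ∷ vs) a b

CycleEdge : ∀ {n} {G : Graph n} → Cycle G → Fin n → Fin n → Set
CycleEdge C u v =
  ConsecIn (verts C) u v ⊎ ConsecIn (verts C) v u
  ⊎ (head (verts C) ≡ just u × last (verts C) ≡ just v)
  ⊎ (head (verts C) ≡ just v × last (verts C) ≡ just u)

-- two cycles are the same subgraph iff they have the same edge set
SameCycle : ∀ {n} {G : Graph n} → Cycle G → Cycle G → Set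
SameCycle C D = ∀ u v → (CycleEdge C u v → CycleEdge D u v) × (CycleEdge D u v → CycleEdge C u v)

Cactus : ∀ {n} → Graph n → Set
Cactus G = Connected G ×
  (∀ (C D : Cycle G) → ¬ SameCycle C D →
     ∀ u v → u ∈ₗ verts C → v ∈ₗ verts C → u ∈ₗ verts D → v ∈ₗ verts D → u ≡ v)

AtLeastTwoCycles : ∀ {n} → Graph n → Set
AtLeastTwoCycles G = Σ (Cycle G) λ C → Σ (Cycle G) λ D → ¬ SameCycle C D

FourCycle : ∀ {n} {G : Graph n} → Cycle G → Set
FourCycle C = length (verts C) ≡ 4

HasOutsideNeighbour : ∀ {n} (G : Graph n) → Cycle G → Fin n → Set
HasOutsideNeighbour G C v = ∃[ w ] (Adj G v w × w ∉ₗ verts C)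

data Blue {n} (G : Graph n) (B : Subset n) : Fin n → Set where
  initial : ∀ {v} → v ∈ B → Blue G B v
  force   : ∀ {u v} → Blue G B u → Adj G u v →
            (∀ w → Adj G u w → w ≢ v → Blue G B w) → Blue G B v

IsZeroForcingSet : ∀ {n} → Graph n → Subset n → Set
IsZeroForcingSet G B = ∀ v → Blue G B v

ZeroForcingNumber≥ : ∀ {n} → Graph n → ℕ → Set
ZeroForcingNumber≥ {n} G m = ∀ (B : Subset n) → IsZeroForcingSet G B → ∣ B ∣ ≥ m

-- A set F of vertices is a fort of a graph H if every vertex outside F with a neighbour in F
-- has at least two; a fort containing no initially blue vertex stays white forever.
-- In the complement of G, a set F fails to be a fort only through a vertex outside F that is
-- G-adjacent to all members of F but one. Given four white vertices, such a vertex has three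
-- white G-neighbours x, y, z; a failure of {x, y, z} to be a fort then produces a square
-- u x u' y in G with an exit z at u, and the hypothesis on squares (together with the cactus
-- property, which makes the square chordless) shows that {x, y} is a fort. So every zero
-- forcing set of the complement misses at most three vertices.
module Submission where

open import Defs
open import Data.Nat using (ℕ; _∸_)
open import Data.Product using (_×_; Σ)
open import Data.List.Membership.Propositional using (_∈_)
open import Relation.Nullary using (¬_)

open import Data.List.Membership.Propositional using (_∉_)
open import Data.Nat using (suc; _+_; _≤_; z≤n; s≤s; _≤?_)
open import Data.Nat.Properties
  using (≰⇒>; ∸-monoˡ-≤; +-monoʳ-≤; m≤n+m∸n; m+n∸n≡m; module ≤-Reasoning)
open import Data.Fin using (Fin; zero; suc)
open import Data.Fin.Properties using (suc-injective)
open import Data.Fin.Subset using (Subset; inside; outside; ∁; ∣_∣) renaming (_∈_ to _∈ₛ_; _∉_ to _∉ₛ_)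
open import Data.Fin.Subset.Properties using (∣∁p∣≡n∸∣p∣; x∈∁p⇒x∉p)
open import Data.Vec using ([]; _∷_; here; there)
open import Data.List using (List; []; _∷_; length; map; head; last)
open import Data.List.Properties using (length-map)
open import Data.List.Relation.Unary.Any using (here; there)
open import Data.List.Relation.Unary.All as All using (All; []; _∷_)
open import Data.List.Relation.Unary.All.Properties as All using ()
open import Data.List.Relation.Unary.AllPairs using ([]; _∷_)
open import Data.List.Relation.Unary.Unique.Propositional using (Unique)
open import Data.List.Relation.Unary.Unique.Propositional.Properties as Unique using ()
open import Data.Maybe using (just)
open import Data.Product using (_,_; proj₁; proj₂)
open import Data.Sum using (inj₁; inj₂)
open import Data.Empty using (⊥; ⊥-elim)
open import Relation.Binary.PropositionalEquality as ≡ using (_≡_; _≢_; refl; trans; cong; subst; ≢-sym)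
open import Relation.Nullary using (yes; no)

head≡just⇒∈ : ∀ {A : Set} (xs : List A) {x} → head xs ≡ just x → x ∈ xs
head≡just⇒∈ (x ∷ xs) refl = here refl

last≡just⇒∈ : ∀ {A : Set} (xs : List A) {x} → last xs ≡ just x → x ∈ xs
last≡just⇒∈ (x ∷ [])     refl = here refl
last≡just⇒∈ (x ∷ y ∷ xs) eq   = there (last≡just⇒∈ (y ∷ xs) eq)

ConsecIn⇒∈ˡ : ∀ {n} {xs : List (Fin n)} {a b} → ConsecIn xs a b → a ∈ xs
ConsecIn⇒∈ˡ atHead    = here refl
ConsecIn⇒∈ˡ (later c) = there (ConsecIn⇒∈ˡ c)

ConsecIn⇒∈ʳ : ∀ {n} {xs : List (Fin n)} {a b} → ConsecIn xs a b → b ∈ xs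
ConsecIn⇒∈ʳ atHead    = there (here refl)
ConsecIn⇒∈ʳ (later c) = there (ConsecIn⇒∈ʳ c)

cycleEdge⇒∈ : ∀ {n} {G : Graph n} (C : Cycle G) {a b} → CycleEdge C a b → b ∈ verts C
cycleEdge⇒∈ C (inj₁ ab)                     = ConsecIn⇒∈ʳ ab
cycleEdge⇒∈ C (inj₂ (inj₁ ba))              = ConsecIn⇒∈ˡ ba
cycleEdge⇒∈ C (inj₂ (inj₂ (inj₁ (_ , b)))) = last≡just⇒∈ (verts C) b
cycleEdge⇒∈ C (inj₂ (inj₂ (inj₂ (b , _)))) = head≡just⇒∈ (verts C) b

module SmallCycles {n} (G : Graph n) where

  adj⇒≢ : ∀ {u v} → Adj G u v → u ≢ v
  adj⇒≢ uv refl = irrefl G uv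

  triangle : ∀ {u x y} → Adj G u x → Adj G x y → Adj G y u → Cycle G
  triangle ux xy yu = mkCycle (_ ∷ _ ∷ _ ∷ []) (s≤s (s≤s (s≤s z≤n)))
    ((adj⇒≢ ux ∷ ≢-sym (adj⇒≢ yu) ∷ []) ∷ (adj⇒≢ xy ∷ []) ∷ [] ∷ [])
    (cons ux (cons xy one))
    (λ { refl refl → yu })

  square : ∀ {u x u' y} → Adj G u x → Adj G u' x → Adj G u' y → Adj G u y →
           u ≢ u' → x ≢ y → Cycle G
  square ux u'x u'y uy u≢u' x≢y = mkCycle (_ ∷ _ ∷ _ ∷ _ ∷ []) (s≤s (s≤s (s≤s z≤n)))
    ((adj⇒≢ ux ∷ u≢u' ∷ adj⇒≢ uy ∷ []) ∷ (≢-sym (adj⇒≢ u'x) ∷ x≢y ∷ []) ∷ (adj⇒≢ u'y ∷ []) ∷ [] ∷ [])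
    (cons ux (cons (Graph.sym G u'x) (cons u'y one)))
    (λ { refl refl → Graph.sym G uy })

-- Forts are stated negatively because adjacency is not assumed decidable.
Fort : ∀ {n} → Graph n → List (Fin n) → Set
Fort H F = ∀ {u v} → u ∉ F → v ∈ F → Adj H u v → ¬ (∀ w → Adj H u w → w ≢ v → w ∉ F)

fort⇒¬blue : ∀ {n} {H : Graph n} {F B v} → Fort H F → All (_∉ₛ B) F → v ∈ F → ¬ Blue H B v
fort⇒¬blue fort white v∈F (initial v∈B) = All.lookup white v∈F v∈B
fort⇒¬blue fort white v∈F (force blue-u uv blue-rest) =
  fort (λ u∈F → fort⇒¬blue fort white u∈F blue-u) v∈F uv
       (λ w uw w≢v w∈F → fort⇒¬blue fort white w∈F (blue-rest w uw w≢v))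

fort⇒¬zeroForcing : ∀ {n} {H : Graph n} {x xs B} →
                    Fort H (x ∷ xs) → All (_∉ₛ B) (x ∷ xs) → ¬ IsZeroForcingSet H B
fort⇒¬zeroForcing fort white zfs = fort⇒¬blue fort white (here refl) (zfs _)

fort-complement : ∀ {n} (G : Graph n) {F} →
  (∀ {u v} → u ∉ F → v ∈ F → ¬ Adj G u v → ¬ (∀ {w} → w ∈ F → w ≢ v → ¬ ¬ Adj G u w)) →
  Fort (complement G) F
fort-complement G almostUniversal u∉F v∈F (_ , ¬uv) noOther =
  almostUniversal u∉F v∈F ¬uv (λ w∈F w≢v ¬uw → noOther _ ((λ { refl → u∉F w∈F }) , ¬uw) w≢v w∈F)

elements : ∀ {n} → Subset n → List (Fin n)
elements []            = []
elements (inside ∷ p)  = zero ∷ map suc (elements p)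
elements (outside ∷ p) = map suc (elements p)

length-elements : ∀ {n} (p : Subset n) → length (elements p) ≡ ∣ p ∣
length-elements []            = refl
length-elements (inside ∷ p)  = cong suc (trans (length-map suc (elements p)) (length-elements p))
length-elements (outside ∷ p) = trans (length-map suc (elements p)) (length-elements p)

elements-unique : ∀ {n} (p : Subset n) → Unique (elements p)
elements-unique []            = []
elements-unique (inside ∷ p)  =
  All.map⁺ (All.tabulate (λ _ ())) ∷ Unique.map⁺ suc-injective (elements-unique p)
elements-unique (outside ∷ p) = Unique.map⁺ suc-injective (elements-unique p)

elements-∈ : ∀ {n} (p : Subset n) → All (_∈ₛ p) (elements p)
elements-∈ []            = []
elements-∈ (inside ∷ p)  = here ∷ All.map⁺ (All.map there (elements-∈ p))
elements-∈ (outside ∷ p) = All.map⁺ (All.map there (elements-∈ p))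

¬n∸3≤m⇒4≤n∸m : ∀ {n m} → ¬ (n ∸ 3 ≤ m) → 4 ≤ n ∸ m
¬n∸3≤m⇒4≤n∸m {n} {m} n∸3≰m = ≰⇒> λ n∸m≤3 → n∸3≰m (begin
  n ∸ 3             ≤⟨ ∸-monoˡ-≤ 3 (m≤n+m∸n n m) ⟩
  (m + (n ∸ m)) ∸ 3 ≤⟨ ∸-monoˡ-≤ 3 (+-monoʳ-≤ m n∸m≤3) ⟩
  (m + 3) ∸ 3       ≡⟨ m+n∸n≡m m 3 ⟩
  m                 ∎)
  where open ≤-Reasoning

NoAdjacentExitsOnSquares : ∀ {n} → Graph n → Set
NoAdjacentExitsOnSquares G = ∀ (C : Cycle G) → FourCycle C → ∀ u v → u ∈ verts C → v ∈ verts C →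
  Adj G u v → ¬ (HasOutsideNeighbour G C u × HasOutsideNeighbour G C v)

module CactusComplement {n} {G : Graph n} (cactus : Cactus G) (noExits : NoAdjacentExitsOnSquares G) where

  open SmallCycles G

  square-chordless : ∀ {u x u' y} → Adj G u x → Adj G u' x → Adj G u' y → Adj G u y →
                     u ≢ u' → x ≢ y → ¬ Adj G x y
  square-chordless {u} {x} {u'} {y} ux u'x u'y uy u≢u' x≢y xy =
    adj⇒≢ ux (proj₂ cactus C D C≠D u x (here refl) (there (here refl)) (here refl) (there (here refl)))
    where
    C = square ux u'x u'y uy u≢u' x≢y
    D = triangle ux xy (Graph.sym G uy)
    -- the edge x u' of the square would be an edge of the triangle u x y
    C≠D : ¬ SameCycle C D
    C≠D same with cycleEdge⇒∈ D (proj₁ (same x u') (inj₁ (later atHead)))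
    ... | here u'≡u                 = u≢u' (≡.sym u'≡u)
    ... | there (here u'≡x)         = adj⇒≢ u'x u'≡x
    ... | there (there (here u'≡y)) = adj⇒≢ u'y u'≡y

  square-neighbour⇒neighbour :
    ∀ {u x u' y z t} → Adj G u x → Adj G u' x → Adj G u' y → Adj G u y → u ≢ u' → x ≢ y →
    Adj G u z → z ≢ x → z ≢ u' → z ≢ y → Adj G t y → ¬ ¬ Adj G t x
  square-neighbour⇒neighbour {u} {x} {u'} {y} {z} {t} ux u'x u'y uy u≢u' x≢y uz z≢x z≢u' z≢y ty ¬tx =
    noExits C refl u y (here refl) (there (there (there (here refl)))) uy
      ((z , uz , z∉C) , (t , Graph.sym G ty , t∉C))
    where
    C = square ux u'x u'y uy u≢u' x≢y
    z∉C : z ∉ verts C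
    z∉C (here z≡u) = adj⇒≢ uz (≡.sym z≡u)
    z∉C (there (here z≡x)) = z≢x z≡x
    z∉C (there (there (here z≡u'))) = z≢u' z≡u'
    z∉C (there (there (there (here z≡y)))) = z≢y z≡y
    t∉C : t ∉ verts C
    t∉C (here refl) = ¬tx ux
    t∉C (there (here refl)) = square-chordless ux u'x u'y uy u≢u' x≢y ty
    t∉C (there (there (here refl))) = ¬tx u'x
    t∉C (there (there (there (here refl)))) = irrefl G ty

  square⇒fort :
    ∀ {u x u' y z} → Adj G u x → Adj G u' x → Adj G u' y → Adj G u y → u ≢ u' → x ≢ y →
    Adj G u z → z ≢ x → z ≢ u' → z ≢ y → Fort (complement G) (x ∷ y ∷ [])
  square⇒fort ux u'x u'y uy u≢u' x≢y uz z≢x z≢u' z≢y = fort-complement G λ where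
    _ (here refl) ¬tx adjacentToOthers → adjacentToOthers (there (here refl)) (≢-sym x≢y) λ ty →
      square-neighbour⇒neighbour ux u'x u'y uy u≢u' x≢y uz z≢x z≢u' z≢y ty ¬tx
    _ (there (here refl)) ¬ty adjacentToOthers → adjacentToOthers (here refl) x≢y λ tx →
      square-neighbour⇒neighbour uy u'y u'x ux u≢u' (≢-sym x≢y) uz z≢y z≢u' z≢x tx ¬ty

  commonNeighbour⇒¬zeroForcing :
    ∀ {u x y z B} → Adj G u x → Adj G u y → Adj G u z → x ≢ y → x ≢ z → y ≢ z →
    All (_∉ₛ B) (x ∷ y ∷ z ∷ []) → ¬ IsZeroForcingSet (complement G) B
  commonNeighbour⇒¬zeroForcing {u} {x} {y} {z} {B} ux uy uz x≢y x≢z y≢z white@(x∉B ∷ y∉B ∷ z∉B ∷ []) zfs =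
    fort⇒¬zeroForcing (fort-complement G missesOne) white zfs
    where
    squareWithExit : ∀ {a b c u'} → Adj G u a → Adj G u b → Adj G u c →
      Adj G u' a → Adj G u' b → ¬ Adj G u' c → a ≢ b → c ≢ a → c ≢ u' → c ≢ b → a ∉ₛ B → b ∉ₛ B → ⊥
    squareWithExit ua ub uc u'a u'b ¬u'c a≢b c≢a c≢u' c≢b a∉B b∉B =
      fort⇒¬zeroForcing (square⇒fort ua u'a u'b ub (λ { refl → ¬u'c uc }) a≢b uc c≢a c≢u' c≢b)
        (a∉B ∷ b∉B ∷ []) zfs
    missesOne : ∀ {u' v} → u' ∉ x ∷ y ∷ z ∷ [] → v ∈ x ∷ y ∷ z ∷ [] → ¬ Adj G u' v →
                ¬ (∀ {w} → w ∈ x ∷ y ∷ z ∷ [] → w ≢ v → ¬ ¬ Adj G u' w)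
    missesOne u'∉F (here refl) ¬u'x adjacentToOthers =
      adjacentToOthers (there (here refl)) (≢-sym x≢y) λ u'y →
      adjacentToOthers (there (there (here refl))) (≢-sym x≢z) λ u'z →
      squareWithExit uy uz ux u'y u'z ¬u'x y≢z x≢y (λ { refl → u'∉F (here refl) }) x≢z y∉B z∉B
    missesOne u'∉F (there (here refl)) ¬u'y adjacentToOthers =
      adjacentToOthers (here refl) x≢y λ u'x →
      adjacentToOthers (there (there (here refl))) (≢-sym y≢z) λ u'z →
      squareWithExit ux uz uy u'x u'z ¬u'y x≢z (≢-sym x≢y) (λ { refl → u'∉F (there (here refl)) }) y≢z x∉B z∉B
    missesOne u'∉F (there (there (here refl))) ¬u'z adjacentToOthers =
      adjacentToOthers (here refl) x≢z λ u'x →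
      adjacentToOthers (there (here refl)) y≢z λ u'y →
      squareWithExit ux uy uz u'x u'y ¬u'z x≢y (≢-sym x≢z) (λ { refl → u'∉F (there (there (here refl))) }) (≢-sym y≢z) x∉B y∉B

  four-white⇒¬zeroForcing : ∀ {xs B} → 4 ≤ length xs → Unique xs → All (_∉ₛ B) xs →
                            ¬ IsZeroForcingSet (complement G) B
  four-white⇒¬zeroForcing {[]} ()
  four-white⇒¬zeroForcing {_ ∷ []} (s≤s ())
  four-white⇒¬zeroForcing {_ ∷ _ ∷ []} (s≤s (s≤s ()))
  four-white⇒¬zeroForcing {_ ∷ _ ∷ _ ∷ []} (s≤s (s≤s (s≤s ())))
  four-white⇒¬zeroForcing {a ∷ b ∷ c ∷ d ∷ _} {B} _
    ((a≢b ∷ a≢c ∷ a≢d ∷ _) ∷ (b≢c ∷ b≢d ∷ _) ∷ (c≢d ∷ _) ∷ _) (a∉B ∷ b∉B ∷ c∉B ∷ d∉B ∷ _) zfs =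
    fort⇒¬zeroForcing (fort-complement G missesOne) (a∉B ∷ b∉B ∷ c∉B ∷ d∉B ∷ []) zfs
    where
    F = a ∷ b ∷ c ∷ d ∷ []
    missesOne : ∀ {u v} → u ∉ F → v ∈ F → ¬ Adj G u v → ¬ (∀ {w} → w ∈ F → w ≢ v → ¬ ¬ Adj G u w)
    missesOne _ (here refl) _ adjacentToOthers =
      adjacentToOthers (there (here refl)) (≢-sym a≢b) λ ub →
      adjacentToOthers (there (there (here refl))) (≢-sym a≢c) λ uc →
      adjacentToOthers (there (there (there (here refl)))) (≢-sym a≢d) λ ud →
      commonNeighbour⇒¬zeroForcing ub uc ud b≢c b≢d c≢d (b∉B ∷ c∉B ∷ d∉B ∷ []) zfs
    missesOne _ (there (here refl)) _ adjacentToOthers =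
      adjacentToOthers (here refl) a≢b λ ua →
      adjacentToOthers (there (there (here refl))) (≢-sym b≢c) λ uc →
      adjacentToOthers (there (there (there (here refl)))) (≢-sym b≢d) λ ud →
      commonNeighbour⇒¬zeroForcing ua uc ud a≢c a≢d c≢d (a∉B ∷ c∉B ∷ d∉B ∷ []) zfs
    missesOne _ (there (there (here refl))) _ adjacentToOthers =
      adjacentToOthers (here refl) a≢c λ ua →
      adjacentToOthers (there (here refl)) b≢c λ ub →
      adjacentToOthers (there (there (there (here refl)))) (≢-sym c≢d) λ ud →
      commonNeighbour⇒¬zeroForcing ua ub ud a≢b a≢d b≢d (a∉B ∷ b∉B ∷ d∉B ∷ []) zfs
    missesOne _ (there (there (there (here refl)))) _ adjacentToOthers =
      adjacentToOthers (here refl) a≢d λ ua →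
      adjacentToOthers (there (here refl)) b≢d λ ub →
      adjacentToOthers (there (there (here refl))) c≢d λ uc →
      commonNeighbour⇒¬zeroForcing ua ub uc a≢b a≢c b≢c (a∉B ∷ b∉B ∷ c∉B ∷ []) zfs

proposition4p6 : ∀ (n : ℕ) (G : Graph n) → Cactus G → AtLeastTwoCycles G → Σ (Cycle G) FourCycle → (∀ (C : Cycle G) → FourCycle C → ∀ u v → u ∈ verts C → v ∈ verts C → Adj G u v → ¬ (HasOutsideNeighbour G C u × HasOutsideNeighbour G C v)) → ZeroForcingNumber≥ (complement G) (n ∸ 3)
proposition4p6 n G cactus _ _ noExits B zfs with n ∸ 3 ≤? ∣ B ∣
... | yes n∸3≤∣B∣ = n∸3≤∣B∣
... | no n∸3≰∣B∣ = ⊥-elim (four-white⇒¬zeroForcing enough (elements-unique (∁ B)) white zfs)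
  where
  open CactusComplement cactus noExits
  enough : 4 ≤ length (elements (∁ B))
  enough = subst (4 ≤_) (≡.sym (trans (length-elements (∁ B)) (∣∁p∣≡n∸∣p∣ B))) (¬n∸3≤m⇒4≤n∸m n∸3≰∣B∣)
  white : All (_∉ₛ B) (elements (∁ B))
  white = All.map x∈∁p⇒x∉p (elements-∈ (∁ B))
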